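{- Let $e=\{v_1,\dots,v_r\}$ be an $r$-node hyperedge with a move-based splitting function whose penalties are $m_i$ ($0\le i\le r-1$) for partitions with exactly $i$ nodes outside a largest cluster, extended by a value $m_r$, and define $\mathbf{m}_e:2^e\to\mathbb{R}$ by $\mathbf{m}_e(S)=m_{|S|}$ for all $S\subseteq e$. If $m_r=m_{r-2}$ and $\mathbf{m}_e$ is submodular, then $2m_1\ge m_2$; $2m_j\ge m_{j-1}+m_{j+1}$ for $j\in\{1,2,\dots,r-3\}$; and $m_{j+1}\ge m_j$ for $j\in\{1,2,\dots,r-2\}$.
   Context: For a finite set $e$ and integer $k\ge2$, a $k$-way splitting function assigns to each $k$-tuple $P=(e_1,\dots,e_k)$ of pairwise disjoint (possibly empty) subsets with union $e$ a value $\mathbf{z}_e(P)\ge0$, invariant under permuting the clusters, and equal to $0$ when only one cluster is nonempty. It is move-based if $\mathbf{z}_e(P)$ depends only on the number of nodes of $e$ not in a largest cluster of $P$; $m_i$ denotes this value when that number is $i$ (so $m_0=0$). $\mathbf{m}_e$ is submodular if $\mathbf{m}_e(A)+\mathbf{m}_e(B)\ge\mathbf{m}_e(A\cap B)+\mathbf{m}_e(A\cup B)$ for all $A,B\subseteq e$. -}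

module Defs where

open import Level using (Level; _⊔_) renaming (suc to lsuc)
open import Data.Nat using (ℕ)
open import Data.Fin.Subset using (Subset; ∣_∣; _∩_; _∪_)
open import Algebra.Bundles using (AbelianGroup)
open import Relation.Binary.Core using (Rel)
open import Relation.Binary.Structures using (IsTotalOrder)

-- The standard library has
-- no reals, so we work over an arbitrary totally ordered abelian group
-- (ℝ with + and ≤ is an instance); the statement only uses addition and order.
record OrderedAbelianGroup (c ℓ₁ ℓ₂ : Level) : Set (lsuc (c ⊔ ℓ₁ ⊔ ℓ₂)) where
  field
    abelianGroup : AbelianGroup c ℓ₁
  open AbelianGroup abelianGroup public
  field
    _≤_          : Rel Carrier ℓ₂
    isTotalOrder : IsTotalOrder _≈_ _≤_
    ≤-compat     : ∀ {x y} z → x ≤ y → (x ∙ z) ≤ (y ∙ z)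

module _ {c ℓ₁ ℓ₂} (G : OrderedAbelianGroup c ℓ₁ ℓ₂) where
  open OrderedAbelianGroup G

  mₑ : (r : ℕ) → (ℕ → Carrier) → Subset r → Carrier
  mₑ r m S = m ∣ S ∣

  Submodular : (r : ℕ) → (Subset r → Carrier) → Set ℓ₂
  Submodular r f = ∀ (A B : Subset r) → (f (A ∩ B) ∙ f (A ∪ B)) ≤ (f A ∙ f B)

module Submission where

-- For a set function S ↦ m ∣S∣ on the r-element set Fin r,
-- submodularity applied to two subsets A, B of size k+1 that share exactly
-- k elements (so ∣A ∩ B∣ = k and ∣A ∪ B∣ = k+2) yields the discrete
-- concavity inequality  m k + m (k+2) ≤ 2 m (k+1)  for every k with k+2 ≤ r.
-- The first two claims of the theorem are instances of it (for k = 0 using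
-- m 0 = 0).  For monotonicity, concavity propagates "m k ≤ m (k+1)"
-- downwards: if m (k+1) ≤ m (k+2) then m k ≤ m (k+1).  The top case
-- k = r-2 follows from m r = m (r-2): in a total order either already
-- m (r-2) ≤ m (r-1), or m (r-1) ≤ m (r-2) = m r and the propagation step
-- applies once more.

open import Defs
open import Data.Nat using (ℕ; zero; suc; _+_; _∸_; _<_; s≤s; z≤n)
  renaming (_≤_ to _≤ℕ_)
import Data.Nat.Properties as ℕ
open import Data.Product using (_×_; _,_; proj₁; proj₂)
open import Data.Sum using (inj₁; inj₂)
open import Data.Bool using (true; false)
open import Data.Vec using (_∷_)
open import Data.Fin.Subset using (Subset; ∣_∣; _∩_; _∪_; ⊥)
open import Data.Fin.Subset.Properties using (∣⊥∣≡0; ∩-idem; ∪-idem)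
open import Relation.Binary.PropositionalEquality as ≡
  using (_≡_; refl; cong; subst)

-- Two subsets of Fin (k + 2 + t): both contain the first k points, the
-- point k lies only in the first and the point k+1 only in the second.
exchangeˡ exchangeʳ : (k t : ℕ) → Subset (suc (suc (k + t)))
exchangeˡ zero    t = true ∷ false ∷ ⊥
exchangeˡ (suc k) t = true ∷ exchangeˡ k t
exchangeʳ zero    t = false ∷ true ∷ ⊥
exchangeʳ (suc k) t = true ∷ exchangeʳ k t

∣exchangeˡ∣ : ∀ k t → ∣ exchangeˡ k t ∣ ≡ suc k
∣exchangeˡ∣ zero    t = cong suc (∣⊥∣≡0 t)
∣exchangeˡ∣ (suc k) t = cong suc (∣exchangeˡ∣ k t)

∣exchangeʳ∣ : ∀ k t → ∣ exchangeʳ k t ∣ ≡ suc k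
∣exchangeʳ∣ zero    t = cong suc (∣⊥∣≡0 t)
∣exchangeʳ∣ (suc k) t = cong suc (∣exchangeʳ∣ k t)

∣exchange-∩∣ : ∀ k t → ∣ exchangeˡ k t ∩ exchangeʳ k t ∣ ≡ k
∣exchange-∩∣ zero    t = ≡.trans (cong ∣_∣ (∩-idem (⊥ {n = t}))) (∣⊥∣≡0 t)
∣exchange-∩∣ (suc k) t = cong suc (∣exchange-∩∣ k t)

∣exchange-∪∣ : ∀ k t → ∣ exchangeˡ k t ∪ exchangeʳ k t ∣ ≡ suc (suc k)
∣exchange-∪∣ zero    t = cong (λ n → suc (suc n)) (≡.trans (cong ∣_∣ (∪-idem (⊥ {n = t}))) (∣⊥∣≡0 t))
∣exchange-∪∣ (suc k) t = cong suc (∣exchange-∪∣ k t)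

module _ {c ℓ₁ ℓ₂} (G : OrderedAbelianGroup c ℓ₁ ℓ₂) where
  open OrderedAbelianGroup G
  open import Relation.Binary.Structures using (IsTotalOrder; IsPartialOrder; IsPreorder)
  open IsTotalOrder isTotalOrder using (total; isPartialOrder)
  open IsPartialOrder isPartialOrder using (≤-resp-≈)
  open IsPreorder (IsPartialOrder.isPreorder isPartialOrder)
    renaming (trans to ≤-trans; reflexive to ≤-reflexive)
  open import Relation.Binary.Reasoning.Setoid setoid

  ≤-respʳ-≈ : ∀ {x y z} → y ≈ z → x ≤ y → x ≤ z
  ≤-respʳ-≈ = proj₁ ≤-resp-≈

  ≤-respˡ-≈ : ∀ {x y z} → y ≈ z → y ≤ x → z ≤ x
  ≤-respˡ-≈ = proj₂ ≤-resp-≈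

  ≤-compatˡ : ∀ {x y} z → x ≤ y → (z ∙ x) ≤ (z ∙ y)
  ≤-compatˡ {x} {y} z x≤y = ≤-respʳ-≈ (comm y z) (≤-respˡ-≈ (comm x z) (≤-compat z x≤y))

  ≤-cancelʳ : ∀ {x y} z → (x ∙ z) ≤ (y ∙ z) → x ≤ y
  ≤-cancelʳ {x} {y} z xz≤yz =
    ≤-respʳ-≈ (undo y) (≤-respˡ-≈ (undo x) (≤-compat (z ⁻¹) xz≤yz))
    where
    undo : ∀ w → ((w ∙ z) ∙ (z ⁻¹)) ≈ w
    undo w = begin
      (w ∙ z) ∙ (z ⁻¹) ≈⟨ assoc w z (z ⁻¹) ⟩
      w ∙ (z ∙ (z ⁻¹)) ≈⟨ ∙-congˡ (inverseʳ z) ⟩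
      w ∙ ε            ≈⟨ identityʳ w ⟩
      w                ∎

  -- The propagation step: if a + c ≤ 2b and b ≤ c, then a ≤ b,
  -- since a + b ≤ a + c ≤ b + b.
  concave-step : ∀ {a b c} → (a ∙ c) ≤ (b ∙ b) → b ≤ c → a ≤ b
  concave-step {a} {b} ac≤bb b≤c = ≤-cancelʳ b (≤-trans (≤-compatˡ a b≤c) ac≤bb)

  ConcaveUpTo : ℕ → (ℕ → Carrier) → Set ℓ₂
  ConcaveUpTo n m = ∀ k → k ≤ℕ n → (m k ∙ m (suc (suc k))) ≤ (m (suc k) ∙ m (suc k))

  submodular⇒concave : ∀ n (m : ℕ → Carrier) →
    Submodular G (suc (suc n)) (mₑ G (suc (suc n)) m) → ConcaveUpTo n m
  submodular⇒concave n m sub k k≤n =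
    subst (λ n′ → Submodular G (suc (suc n′)) (mₑ G (suc (suc n′)) m) → _)
          (ℕ.m+[n∸m]≡n k≤n) (onExchange (n ∸ k)) sub
    where
    count : ∀ {A B} → A ≡ B → m A ≈ m B
    count eq = reflexive (cong m eq)
    onExchange : ∀ t → Submodular G (suc (suc (k + t))) (mₑ G (suc (suc (k + t))) m) →
      (m k ∙ m (suc (suc k))) ≤ (m (suc k) ∙ m (suc k))
    onExchange t sub′ =
      ≤-respʳ-≈ (∙-cong (count (∣exchangeˡ∣ k t)) (count (∣exchangeʳ∣ k t)))
        (≤-respˡ-≈ (∙-cong (count (∣exchange-∩∣ k t)) (count (∣exchange-∪∣ k t)))
          (sub′ (exchangeˡ k t) (exchangeʳ k t)))

  concave-top : ∀ n (m : ℕ → Carrier) → ConcaveUpTo n m →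
    m (suc (suc n)) ≈ m n → m n ≤ m (suc n)
  concave-top n m concave wrap with total (m n) (m (suc n))
  ... | inj₁ rising  = rising
  ... | inj₂ falling =
    concave-step (concave n ℕ.≤-refl) (≤-respʳ-≈ (sym wrap) falling)

  concave-monotone : ∀ n (m : ℕ → Carrier) → ConcaveUpTo n m →
    m n ≤ m (suc n) → ∀ k → k ≤ℕ n → m k ≤ m (suc k)
  concave-monotone n m concave rising k k≤n = descend (n ∸ k) k (ℕ.m+[n∸m]≡n k≤n)
    where
    descend : ∀ d k → k + d ≡ n → m k ≤ m (suc k)
    descend zero    k refl = subst (λ i → m i ≤ m (suc i)) (ℕ.+-identityʳ k) rising
    descend (suc d) k refl =
      concave-step (concave k (ℕ.m≤m+n k (suc d))) (descend d (suc k) (≡.sym (ℕ.+-suc k d)))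

lemma6p9 : ∀ {c ℓ₁ ℓ₂} (G : OrderedAbelianGroup c ℓ₁ ℓ₂) →
    let open OrderedAbelianGroup G in
    (r : ℕ) → 2 ≤ℕ r →
    (m : ℕ → Carrier) →
    m 0 ≈ ε →
    (∀ i → i < r → ε ≤ m i) →
    m r ≈ m (r ∸ 2) →
    Submodular G r (mₑ G r m) →
    (m 2 ≤ (m 1 ∙ m 1))
    × (∀ j → 1 ≤ℕ j → j ≤ℕ r ∸ 3 → (m (j ∸ 1) ∙ m (suc j)) ≤ (m j ∙ m j))
    × (∀ j → 1 ≤ℕ j → j ≤ℕ r ∸ 2 → m j ≤ m (suc j))
lemma6p9 G (suc (suc n)) (s≤s (s≤s z≤n)) m m0≈ε _ wrap sub =
  ≤-respˡ-≈ G (trans (∙-congʳ m0≈ε) (identityˡ (m 2))) (concave 0 z≤n)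
  , interiorConcavity
  , (λ j _ j≤n → concave-monotone G n m concave (concave-top G n m concave wrap) j j≤n)
  where
  open OrderedAbelianGroup G
  concave : ConcaveUpTo G n m
  concave = submodular⇒concave G n m sub
  interiorConcavity : ∀ j → 1 ≤ℕ j → j ≤ℕ n ∸ 1 → (m (j ∸ 1) ∙ m (suc j)) ≤ (m j ∙ m j)
  interiorConcavity (suc i) _ i<n∸1 =
    concave i (ℕ.≤-trans (ℕ.n≤1+n i) (ℕ.≤-trans i<n∸1 (ℕ.m∸n≤m n 1)))
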